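{- Let $\psi$ be a basic formula over $\Sigma$, and suppose $\mathfrak{A}\models\psi$ for some quadratic structure $\mathfrak{A}$ interpreting $\Sigma$. Then $\mathcal{C}(\mathfrak{A})\models\psi$.
   Context: $\Sigma$ is a finite set of unary predicates containing a distinguished unary $\hat T$; $T$ is a distinguished binary predicate interpreted as a transitive relation, and $\hat T$ as $\{a:(a,a)\in T\}$. $\Pi_\Sigma$ is the set of fluted 1-types over $\Sigma$; $\pi,\pi'$ range over them and $\mu$ over quantifier-free one-variable formulas over $\Sigma$. Basic formulas: (B1) $\forall x(\pi(x)\rightarrow\exists y(\mu(y)\wedge T(x,y)\wedge x\ne y))$; (B2) same with $\neg T(x,y)$; (B3) $\forall x(\pi(x)\rightarrow\forall y(\pi'(y)\rightarrow T(x,y)))$, $\pi\ne\pi'$; (B4) same with $\neg T$; (B5) $\forall x(\pi(x)\rightarrow\forall y(\pi(y)\rightarrow x=y\vee T(x,y)))$; (B6) same with $\neg T$; (B7) $\forall x\,\mu(x)$; (B8) $\exists x\,\mu(x)$. Cliques, quadratic structures, clique-types $\xi:\Pi_\Sigma\to\{0,1,2\}$ (with $\pi\in\xi$ iff $\xi(\pi)\ge1$), clique-super-types $(\xi,\Pi)$, $\mathrm{cstp}^\mathfrak{A}[a]$ and $\mathcal{C}(\mathfrak{A})$ are as follows: a clique is a maximal set $B$ with $T(a,b)$ for all distinct $a,b\in B$; $\mathfrak{A}$ is quadratic if whenever a clique $B$ is the unique clique in which both types of some pair $\{\pi,\pi'\}$ are realized, some type $\pi^*$ is realized in $B$ and in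 no other clique; $\mathrm{ctp}^\mathfrak{A}[a](\pi)$ is $2,1,0$ according as $\pi$ is realized by $\ge2$, exactly $1$, or no element of $a$'s clique; $\mathrm{cstp}^\mathfrak{A}[a]=(\mathrm{ctp}^\mathfrak{A}[a],\{\mathrm{ftp}^\mathfrak{A}[b]:T(a,b),\neg T(b,a)\})$; $\mathcal{C}(\mathfrak{A})=\langle\Omega,\ll,V\rangle$ with $\Omega$ the set of realized clique-super-types, $\pi\ll\pi'$ iff both are realized, $\mathfrak{A}\models\forall x(\pi(x)\rightarrow\forall y(\pi'(y)\rightarrow T(x,y)))$ and $\mathfrak{A}\not\models\forall x(\pi'(x)\rightarrow\forall y(\pi(y)\rightarrow T(x,y)))$, and $V$ the set of types realized in exactly one clique. For a triple $\mathcal{C}=\langle\Omega,\ll,V\rangle$ ($\Omega$ a set of clique-super-types, $\ll$ a relation on $\Pi_\Sigma$, $V\subseteq\Pi_\Sigma$), say $\pi$ occurs in $\mathcal{C}$ if $\pi\in\xi$ for some $(\xi,\Pi)\in\Omega$, and define $\mathcal{C}\models\psi$: (1) for (B1): for all $(\xi,\Pi)\in\Omega$ with $\pi\in\xi$, either $\models\pi\rightarrow\mu$ and $\xi(\pi)=2$, or some $\pi'\in\xi$ with $\pi'\ne\pi$ has $\models\pi'\rightarrow\mu$, or some $\pi'\in\Pi$ has $\models\pi'\rightarrow\mu$; (2) for (B2): for all $(\xi,\Pi)\in\Omega$ with $\pi\in\xi$ there are $(\xi',\Pi')\in\Omega$ and $\pi'\in\xi'$ with $\models\pi'\rightarrow\mu$,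 no $\pi''\in\Pi$, $\pi'''\in\xi'$ with $\pi''\ll\pi'''$, $\xi'\cap\Pi\cap V=\emptyset$, and $(\xi,\Pi)=(\xi',\Pi')\Rightarrow\xi\cap V=\emptyset$; (3) for (B3): either one of $\pi,\pi'$ does not occur in $\mathcal{C}$, or $\pi\ll\pi'$, or for all $(\xi,\Pi),(\xi',\Pi')\in\Omega$ with $\pi\in\xi$ and $\pi'\in\xi'$ we have $\xi=\xi'$, $\Pi=\Pi'$ and $\xi\cap V\ne\emptyset$; (4) for (B4): for all $(\xi,\Pi)\in\Omega$ with $\pi\in\xi$, $\pi'\notin\xi\cup\Pi$; (5) for (B5): at most one $(\xi,\Pi)\in\Omega$ has $\pi\in\xi$, and if one exists then $\xi\cap V\ne\emptyset$; (6) for (B6): for all $(\xi,\Pi)\in\Omega$, $\pi\notin\xi\cap\Pi$ and $\xi(\pi)\le1$; (7) for (B7): for all $(\xi,\Pi)\in\Omega$ and $\pi\in\xi$, $\models\pi\rightarrow\mu$; (8) for (B8): some $(\xi,\Pi)\in\Omega$ and $\pi\in\xi$ have $\models\pi\rightarrow\mu$. -}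

module Defs where

open import Level using (0ℓ) renaming (suc to lsuc)
open import Data.Nat using (ℕ; suc)
open import Data.Fin using (Fin; zero)
open import Data.Bool using (Bool; true; false; not; _∧_; _∨_)
open import Data.Vec using (Vec; tabulate; lookup)
open import Data.Product using (Σ; ∃; ∃-syntax; _×_; _,_)
open import Data.Sum using (_⊎_)
open import Relation.Nullary using (¬_)
open import Relation.Binary.PropositionalEquality using (_≡_; _≢_; _≗_)

-- Signature: Σ = Fin (suc n) unary predicates; index zero is the
-- distinguished predicate T̂.

T̂ : {n : ℕ} → Fin (suc n)
T̂ = zero

OneType : ℕ → Set
OneType n = Vec Bool (suc n)

data QF (n : ℕ) : Set where
  atom : Fin (suc n) → QF n
  ⊤f ⊥f : QF n
  ¬f_ : QF n → QF n
  _∧f_ _∨f_ : QF n → QF n → QF n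

⟦_⟧ : {n : ℕ} → QF n → OneType n → Bool
⟦ atom i ⟧ π = lookup π i
⟦ ⊤f ⟧ π = true
⟦ ⊥f ⟧ π = false
⟦ ¬f μ ⟧ π = not (⟦ μ ⟧ π)
⟦ μ ∧f ν ⟧ π = ⟦ μ ⟧ π ∧ ⟦ ν ⟧ π
⟦ μ ∨f ν ⟧ π = ⟦ μ ⟧ π ∨ ⟦ ν ⟧ π

-- ⊨ π → μ   (π is a complete 1-type, so this is: μ is true under π)
_⊨→_ : {n : ℕ} → OneType n → QF n → Set
π ⊨→ μ = ⟦ μ ⟧ π ≡ true

record Structure (n : ℕ) : Set₁ where
  field
    D     : Set
    P     : Fin (suc n) → D → Bool
    T     : D → D → Set
    trans : ∀ {a b c} → T a b → T b c → T a c
    hatT  : ∀ a → (P T̂ a ≡ true → T a a) × (T a a → P T̂ a ≡ true)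

module _ {n : ℕ} (𝔄 : Structure n) where
  open Structure 𝔄

  ftp : D → OneType n
  ftp a = tabulate (λ i → P i a)

  Realized : OneType n → Set
  Realized π = ∃[ a ] ftp a ≡ π

  Pairwise : (D → Set) → Set
  Pairwise B = ∀ a b → B a → B b → a ≢ b → T a b

  IsClique : (D → Set) → Set₁
  IsClique B = Pairwise B ×
    (∀ (B' : D → Set) → (∀ x → B x → B' x) → Pairwise B' → ∀ x → B' x → B x)

  SameSet : (D → Set) → (D → Set) → Set
  SameSet B B' = ∀ x → (B x → B' x) × (B' x → B x)

  RealizedIn : (D → Set) → OneType n → Set
  RealizedIn B π = ∃[ a ] (B a × ftp a ≡ π)

  UniqueCliqueOf : (D → Set) → OneType n → Set₁
  UniqueCliqueOf B π =
    ∀ (B' : D → Set) → IsClique B' → RealizedIn B' π → SameSet B' B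

  Quadratic : Set₁
  Quadratic =
    ∀ (π π' : OneType n) → π ≢ π' → ∀ (B : D → Set) → IsClique B →
    RealizedIn B π → RealizedIn B π' →
    (∀ (B' : D → Set) → IsClique B' → RealizedIn B' π → RealizedIn B' π' →
       SameSet B' B) →
    ∃[ π* ] (RealizedIn B π* × UniqueCliqueOf B π*)

data Mult : Set where
  m0 m1 m2 : Mult

CliqueType : ℕ → Set
CliqueType n = OneType n → Mult

_∈ξ_ : {n : ℕ} → OneType n → CliqueType n → Set
π ∈ξ ξ = ξ π ≢ m0

TypeSet : ℕ → Set
TypeSet n = OneType n → Bool

_∈Π_ : {n : ℕ} → OneType n → TypeSet n → Set
π ∈Π Π = Π π ≡ true

CST : ℕ → Set
CST n = CliqueType n × TypeSet n

module _ {n : ℕ} (𝔄 : Structure n) where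
  open Structure 𝔄

  HasMult : Mult → (D → Set) → OneType n → Set
  HasMult m0 B π = ¬ RealizedIn 𝔄 B π
  HasMult m1 B π = ∃[ a ] (B a × ftp 𝔄 a ≡ π ×
                           (∀ b → B b → ftp 𝔄 b ≡ π → b ≡ a))
  HasMult m2 B π = ∃[ a ] ∃[ b ] (a ≢ b × B a × B b ×
                                  ftp 𝔄 a ≡ π × ftp 𝔄 b ≡ π)

  CtpIs : D → CliqueType n → Set₁
  CtpIs a ξ = ∀ (B : D → Set) → IsClique 𝔄 B → B a →
              ∀ π → HasMult (ξ π) B π

  CstpIs : D → CST n → Set₁
  CstpIs a (ξ , Π) = CtpIs a ξ ×
    (∀ π → (π ∈Π Π → ∃[ b ] (T a b × ¬ T b a × ftp 𝔄 b ≡ π)) ×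
           (∃[ b ] (T a b × ¬ T b a × ftp 𝔄 b ≡ π) → π ∈Π Π))

record Triple (n : ℕ) : Set₂ where
  field
    Ω   : CST n → Set₁
    _≪_ : OneType n → OneType n → Set₁
    V   : OneType n → Set₁

𝒞 : {n : ℕ} → Structure n → Triple n
𝒞 {n} 𝔄 = record
  { Ω   = λ σ → ∃[ a ] CstpIs 𝔄 a σ
  ; _≪_ = λ π π' → Lift1 (Realized 𝔄 π × Realized 𝔄 π' ×
                          AllT π π' × ¬ AllT π' π)
  ; V   = λ π → ∃[ B ] (IsClique 𝔄 B × RealizedIn 𝔄 B π × UniqueCliqueOf 𝔄 B π)
  }
  where
  open Structure 𝔄
  open import Level using (Lift)
  Lift1 : Set → Set₁
  Lift1 = Lift (lsuc 0ℓ)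
  AllT : OneType n → OneType n → Set
  AllT π π' = ∀ a → ftp 𝔄 a ≡ π → ∀ b → ftp 𝔄 b ≡ π' → T a b

data Basic (n : ℕ) : Set where
  B1 B2 : OneType n → QF n → Basic n
  B3 B4 : (π π' : OneType n) → π ≢ π' → Basic n
  B5 B6 : OneType n → Basic n
  B7 B8 : QF n → Basic n

_⊨_ : {n : ℕ} → Structure n → Basic n → Set
𝔄 ⊨ B1 π μ = ∀ a → ftp 𝔄 a ≡ π →
  ∃[ b ] (ftp 𝔄 b ⊨→ μ × Structure.T 𝔄 a b × a ≢ b)
𝔄 ⊨ B2 π μ = ∀ a → ftp 𝔄 a ≡ π →
  ∃[ b ] (ftp 𝔄 b ⊨→ μ × ¬ Structure.T 𝔄 a b × a ≢ b)
𝔄 ⊨ B3 π π' _ = ∀ a → ftp 𝔄 a ≡ π → ∀ b → ftp 𝔄 b ≡ π' → Structure.T 𝔄 a b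
𝔄 ⊨ B4 π π' _ = ∀ a → ftp 𝔄 a ≡ π → ∀ b → ftp 𝔄 b ≡ π' → ¬ Structure.T 𝔄 a b
𝔄 ⊨ B5 π = ∀ a → ftp 𝔄 a ≡ π → ∀ b → ftp 𝔄 b ≡ π → a ≡ b ⊎ Structure.T 𝔄 a b
𝔄 ⊨ B6 π = ∀ a → ftp 𝔄 a ≡ π → ∀ b → ftp 𝔄 b ≡ π → a ≡ b ⊎ ¬ Structure.T 𝔄 a b
𝔄 ⊨ B7 μ = ∀ a → ftp 𝔄 a ⊨→ μ
𝔄 ⊨ B8 μ = ∃[ a ] (ftp 𝔄 a ⊨→ μ)

module _ {n : ℕ} (C : Triple n) where
  open Triple C

  MeetsV : CliqueType n → Set₁
  MeetsV ξ = ∃[ ρ ] (ρ ∈ξ ξ × V ρ)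

  Occurs : OneType n → Set₁
  Occurs π = ∃[ ξ ] ∃[ Π ] (Ω (ξ , Π) × π ∈ξ ξ)

  Sat : Basic n → Set₁
  Sat (B1 π μ) = ∀ ξ Π → Ω (ξ , Π) → π ∈ξ ξ →
      (π ⊨→ μ × ξ π ≡ m2)
    ⊎ (∃[ π' ] (π' ∈ξ ξ × π' ≢ π × π' ⊨→ μ))
    ⊎ (∃[ π' ] (π' ∈Π Π × π' ⊨→ μ))
  Sat (B2 π μ) = ∀ ξ Π → Ω (ξ , Π) → π ∈ξ ξ →
    ∃[ ξ' ] ∃[ Π' ] ∃[ π' ] (Ω (ξ' , Π') × π' ∈ξ ξ' × π' ⊨→ μ ×
      ¬ (∃[ π'' ] ∃[ π''' ] (π'' ∈Π Π × π''' ∈ξ ξ' × π'' ≪ π''')) ×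
      ¬ (∃[ ρ ] (ρ ∈ξ ξ' × ρ ∈Π Π × V ρ)) ×
      ((ξ ≗ ξ' × Π ≗ Π') → ¬ MeetsV ξ))
  Sat (B3 π π' _) = ¬ Occurs π ⊎ ¬ Occurs π' ⊎ π ≪ π' ⊎
    (∀ ξ Π ξ' Π' → Ω (ξ , Π) → Ω (ξ' , Π') → π ∈ξ ξ → π' ∈ξ ξ' →
       ξ ≗ ξ' × Π ≗ Π' × MeetsV ξ)
  Sat (B4 π π' _) = ∀ ξ Π → Ω (ξ , Π) → π ∈ξ ξ → ¬ π' ∈ξ ξ × ¬ π' ∈Π Π
  Sat (B5 π) =
    (∀ ξ Π ξ' Π' → Ω (ξ , Π) → Ω (ξ' , Π') → π ∈ξ ξ → π ∈ξ ξ' →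
       ξ ≗ ξ' × Π ≗ Π')
    × (∀ ξ Π → Ω (ξ , Π) → π ∈ξ ξ → MeetsV ξ)
  Sat (B6 π) = ∀ ξ Π → Ω (ξ , Π) → ¬ (π ∈ξ ξ × π ∈Π Π) × ξ π ≢ m2
  Sat (B7 μ) = ∀ ξ Π → Ω (ξ , Π) → ∀ π → π ∈ξ ξ → π ⊨→ μ
  Sat (B8 μ) = ∃[ ξ ] ∃[ Π ] ∃[ π ] (Ω (ξ , Π) × π ∈ξ ξ × π ⊨→ μ)

-- Since T is transitive, the cliques of 𝔄 are exactly the classes of the
-- equivalence  a ~ b :⇔ a = b ∨ (T(a,b) ∧ T(b,a)).  Hence every element lies in
-- exactly one clique, its clique-super-type exists (by excluded middle) and
-- depends only on its class.  A type in ctp[a] is realised in the class of a, a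
-- type in the second component is realised strictly T-above a, and all
-- realisers of a type in V lie in one class.  With these facts each basic
-- formula transfers from 𝔄 to 𝒞(𝔄); for (B3) quadraticity supplies the type
-- in V demanded when π and π' only meet in a single clique.
module Submission where

open import Defs
open import Data.Nat using (ℕ)
open import Level using (0ℓ; lift; lower) renaming (suc to lsuc)
open import Axiom.ExcludedMiddle using (ExcludedMiddle)
open import Data.Bool using (true; false)
open import Data.Product using (∃-syntax; _×_; _,_; proj₁; proj₂; swap)
open import Data.Sum using (_⊎_; inj₁; inj₂)
open import Data.Empty using (⊥-elim)
open import Relation.Nullary using (¬_; Dec; yes; no; does)
open import Relation.Nullary.Decidable using (map′)
open import Relation.Binary.PropositionalEquality
  using (_≡_; _≢_; _≗_; refl; sym; trans; subst; cong)

bool-ext : ∀ x y → (x ≡ true → y ≡ true) → (y ≡ true → x ≡ true) → x ≡ y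
bool-ext true  true  _ _ = refl
bool-ext true  false f _ = sym (f refl)
bool-ext false true  _ g = g refl
bool-ext false false _ _ = refl

does-reflects : ∀ {A : Set} (a? : Dec A) → (does a? ≡ true → A) × (A → does a? ≡ true)
does-reflects (yes a)  = (λ _ → a) , (λ _ → refl)
does-reflects (no ¬a) = (λ ()) , (λ a → ⊥-elim (¬a a))

module Classes {n : ℕ} (𝔄 : Structure n) where
  open Structure 𝔄 renaming (trans to T-trans)

  infix 4 _~_
  _~_ : D → D → Set
  a ~ b = a ≡ b ⊎ (T a b × T b a)

  [_] : D → D → Set
  [ a ] = a ~_

  ~-refl : ∀ {a} → a ~ a
  ~-refl = inj₁ refl

  ~-sym : ∀ {a b} → a ~ b → b ~ a
  ~-sym (inj₁ refl)       = inj₁ refl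
  ~-sym (inj₂ (tab , tba)) = inj₂ (tba , tab)

  ~-trans : ∀ {a b c} → a ~ b → b ~ c → a ~ c
  ~-trans (inj₁ refl)        b~c                = b~c
  ~-trans (inj₂ ab)          (inj₁ refl)        = inj₂ ab
  ~-trans (inj₂ (tab , tba)) (inj₂ (tbc , tcb)) = inj₂ (T-trans tab tbc , T-trans tcb tba)

  ~⇒T : ∀ {a b} → a ~ b → a ≢ b → T a b
  ~⇒T (inj₁ a≡b)     a≢b = ⊥-elim (a≢b a≡b)
  ~⇒T (inj₂ (tab , _)) _ = tab

  ~-T-trans : ∀ {a b c} → a ~ b → T b c → T a c
  ~-T-trans (inj₁ refl)      tbc = tbc
  ~-T-trans (inj₂ (tab , _)) tbc = T-trans tab tbc

  T-~-trans : ∀ {a b c} → T a b → b ~ c → T a c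
  T-~-trans tab (inj₁ refl)      = tab
  T-~-trans tab (inj₂ (tbc , _)) = T-trans tab tbc

  strict⇒≁ : ∀ {a b} → T a b → ¬ T b a → ¬ a ~ b
  strict⇒≁ tab ¬tba (inj₁ refl)      = ¬tba tab
  strict⇒≁ tab ¬tba (inj₂ (_ , tba)) = ¬tba tba

  ≡⊎T⇒~ : ∀ {a b} → a ≡ b ⊎ T a b → b ≡ a ⊎ T b a → a ~ b
  ≡⊎T⇒~ (inj₁ a≡b) _          = inj₁ a≡b
  ≡⊎T⇒~ (inj₂ _)   (inj₁ b≡a) = inj₁ (sym b≡a)
  ≡⊎T⇒~ (inj₂ tab) (inj₂ tba) = inj₂ (tab , tba)

  Above : D → OneType n → Set
  Above a π = ∃[ b ] (T a b × ¬ T b a × ftp 𝔄 b ≡ π)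

  Above-resp-~ : ∀ {a a' π} → a ~ a' → Above a π → Above a' π
  Above-resp-~ a~a' (b , tab , ¬tba , tb) =
    b , ~-T-trans (~-sym a~a') tab , (λ tba' → ¬tba (T-~-trans tba' (~-sym a~a'))) , tb

  TypesAboveAre : D → TypeSet n → Set
  TypesAboveAre a Π = ∀ π → (π ∈Π Π → Above a π) × (Above a π → π ∈Π Π)

  typesAbove-unique : ∀ {a a' Π Π'} → TypesAboveAre a Π → TypesAboveAre a' Π' → a ~ a' → Π ≗ Π'
  typesAbove-unique {Π = Π} {Π'} pt pt' a~a' π = bool-ext (Π π) (Π' π)
    (λ p → proj₂ (pt' π) (Above-resp-~ a~a' (proj₁ (pt π) p)))
    (λ p → proj₂ (pt π) (Above-resp-~ (~-sym a~a') (proj₁ (pt' π) p)))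

module Multiplicity {n : ℕ} (𝔄 : Structure n) where

  HasMult⇒realized : ∀ {B π} m → m ≢ m0 → HasMult 𝔄 m B π → RealizedIn 𝔄 B π
  HasMult⇒realized m0 m≢m0 _ = ⊥-elim (m≢m0 refl)
  HasMult⇒realized m1 _ (a , ba , ta , _) = a , ba , ta
  HasMult⇒realized m2 _ (a , _ , _ , ba , _ , ta , _) = a , ba , ta

  realized⇒≢m0 : ∀ {B π} m → HasMult 𝔄 m B π → RealizedIn 𝔄 B π → m ≢ m0
  realized⇒≢m0 m0 ¬r r refl = ¬r r

  two⇒m2 : ∀ {B π} m → HasMult 𝔄 m B π → ∀ x y → x ≢ y → B x → B y →
           ftp 𝔄 x ≡ π → ftp 𝔄 y ≡ π → m ≡ m2
  two⇒m2 m0 ¬r x _ _ bx _ tx _ = ⊥-elim (¬r (x , bx , tx))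
  two⇒m2 m1 (_ , _ , _ , only) x y x≢y bx by tx ty =
    ⊥-elim (x≢y (trans (only x bx tx) (sym (only y by ty))))
  two⇒m2 m2 _ _ _ _ _ _ _ _ = refl

  HasMult-unique : ∀ {B π} m m' → HasMult 𝔄 m B π → HasMult 𝔄 m' B π → m ≡ m'
  HasMult-unique m0 m0 _  _  = refl
  HasMult-unique m0 m1 ¬r h  = ⊥-elim (¬r (HasMult⇒realized m1 (λ ()) h))
  HasMult-unique m0 m2 ¬r h  = ⊥-elim (¬r (HasMult⇒realized m2 (λ ()) h))
  HasMult-unique m1 m0 h  ¬r = ⊥-elim (¬r (HasMult⇒realized m1 (λ ()) h))
  HasMult-unique m1 m1 _  _  = refl
  HasMult-unique m1 m2 h (x , y , x≢y , bx , by , tx , ty) = two⇒m2 m1 h x y x≢y bx by tx ty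
  HasMult-unique m2 m0 h  ¬r = ⊥-elim (¬r (HasMult⇒realized m2 (λ ()) h))
  HasMult-unique m2 m1 (x , y , x≢y , bx , by , tx , ty) h = sym (two⇒m2 m1 h x y x≢y bx by tx ty)
  HasMult-unique m2 m2 _  _  = refl

  HasMult-resp-≐ : ∀ {B B' π} m → SameSet 𝔄 B B' → HasMult 𝔄 m B π → HasMult 𝔄 m B' π
  HasMult-resp-≐ m0 B≐B' ¬r (x , b'x , tx) = ¬r (x , proj₂ (B≐B' x) b'x , tx)
  HasMult-resp-≐ m1 B≐B' (x , bx , tx , only) =
    x , proj₁ (B≐B' x) bx , tx , λ y b'y ty → only y (proj₂ (B≐B' y) b'y) ty
  HasMult-resp-≐ m2 B≐B' (x , y , x≢y , bx , by , tx , ty) =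
    x , y , x≢y , proj₁ (B≐B' x) bx , proj₁ (B≐B' y) by , tx , ty

module Classical (em : ExcludedMiddle (lsuc 0ℓ)) {n : ℕ} (𝔄 : Structure n) where
  open Structure 𝔄 renaming (trans to T-trans)
  open Classes 𝔄
  open Multiplicity 𝔄
  open Triple (𝒞 𝔄) using (Ω; V; _≪_)

  dec : (P : Set) → Dec P
  dec P = map′ lower lift em

  []-isClique : ∀ a → IsClique 𝔄 [ a ]
  []-isClique a = pairwise , maximal
    where
    pairwise : Pairwise 𝔄 [ a ]
    pairwise x y a~x a~y = ~⇒T (~-trans (~-sym a~x) a~y)

    maximal : ∀ B → (∀ x → a ~ x → B x) → Pairwise 𝔄 B → ∀ x → B x → a ~ x
    maximal B [a]⊆B pw x bx with dec (a ≡ x)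
    ... | yes a≡x = inj₁ a≡x
    ... | no  a≢x = inj₂ (pw a x ba bx a≢x , pw x a bx ba (λ x≡a → a≢x (sym x≡a)))
      where ba = [a]⊆B a ~-refl

  clique⇒~ : ∀ {B x z} → IsClique 𝔄 B → B x → B z → x ~ z
  clique⇒~ {x = x} {z} (pw , _) bx bz with dec (x ≡ z)
  ... | yes x≡z = inj₁ x≡z
  ... | no  x≢z = inj₂ (pw x z bx bz x≢z , pw z x bz bx (λ z≡x → x≢z (sym z≡x)))

  clique≐[] : ∀ {B c x} → IsClique 𝔄 B → B x → c ~ x → SameSet 𝔄 B [ c ]
  clique≐[] {x = x} cB@(_ , maximal) bx c~x z =
    (λ bz → ~-trans c~x (clique⇒~ cB bx bz)) ,
    (λ c~z → maximal [ x ] (λ _ → clique⇒~ cB bx) (proj₁ ([]-isClique x)) z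
                     (~-trans (~-sym c~x) c~z))

  ctp-at : ∀ {a ξ} → CtpIs 𝔄 a ξ → ∀ π → HasMult 𝔄 (ξ π) [ a ] π
  ctp-at {a} ct = ct [ a ] ([]-isClique a) ~-refl

  ∈ctp⇒realized : ∀ {a ξ π} → CtpIs 𝔄 a ξ → π ∈ξ ξ → ∃[ c ] (a ~ c × ftp 𝔄 c ≡ π)
  ∈ctp⇒realized {ξ = ξ} {π} ct π∈ξ = HasMult⇒realized (ξ π) π∈ξ (ctp-at ct π)

  ~⇒∈ctp : ∀ {a ξ c} → CtpIs 𝔄 a ξ → a ~ c → ftp 𝔄 c ∈ξ ξ
  ~⇒∈ctp {ξ = ξ} {c} ct a~c =
    realized⇒≢m0 (ξ (ftp 𝔄 c)) (ctp-at ct (ftp 𝔄 c)) (c , a~c , refl)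

  ctp-unique : ∀ {a a' ξ ξ'} → CtpIs 𝔄 a ξ → CtpIs 𝔄 a' ξ' → a ~ a' → ξ ≗ ξ'
  ctp-unique {a} {ξ = ξ} {ξ'} ct ct' a~a' π =
    HasMult-unique (ξ π) (ξ' π) (ctp-at ct π) (ct' [ a ] ([]-isClique a) a~a' π)

  occurs⇒realized : ∀ {π} → Occurs (𝒞 𝔄) π → Realized 𝔄 π
  occurs⇒realized (_ , _ , (_ , ct , _) , π∈ξ) with ∈ctp⇒realized ct π∈ξ
  ... | c , _ , tc = c , tc

  V⇒~ : ∀ {ρ x y} → V ρ → ftp 𝔄 x ≡ ρ → ftp 𝔄 y ≡ ρ → x ~ y
  V⇒~ {x = x} {y} (_ , _ , _ , unique) tx ty =
    proj₂ (Bx≐B y) (proj₁ (By≐B y) ~-refl)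
    where
    Bx≐B = unique [ x ] ([]-isClique x) (x , ~-refl , tx)
    By≐B = unique [ y ] ([]-isClique y) (y , ~-refl , ty)

  multiplicity : ∀ B π → ∃[ m ] HasMult 𝔄 m B π
  multiplicity B π with dec (HasMult 𝔄 m2 B π) | dec (RealizedIn 𝔄 B π)
  ... | yes two | _  = m2 , two
  ... | no ¬two | yes (x , bx , tx) = m1 , x , bx , tx , only
    where
    only : ∀ y → B y → ftp 𝔄 y ≡ π → y ≡ x
    only y by ty with dec (y ≡ x)
    ... | yes y≡x = y≡x
    ... | no  y≢x = ⊥-elim (¬two (y , x , y≢x , by , bx , ty , tx))
  ... | no _    | no ¬r = m0 , ¬r

  ctp : D → CliqueType n
  ctp a π = proj₁ (multiplicity [ a ] π)

  typesAbove : D → TypeSet n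
  typesAbove a π = does (dec (Above a π))

  ctp-correct : ∀ a → CtpIs 𝔄 a (ctp a)
  ctp-correct a B cB ba π =
    HasMult-resp-≐ (ctp a π) (λ x → swap (clique≐[] cB ba ~-refl x)) (proj₂ (multiplicity [ a ] π))

  typesAbove-correct : ∀ a → TypesAboveAre a (typesAbove a)
  typesAbove-correct a π = does-reflects (dec (Above a π))

  cstp-realized : ∀ a → Ω (ctp a , typesAbove a)
  cstp-realized a = a , ctp-correct a , typesAbove-correct a

  sat-B1 : ∀ π μ → 𝔄 ⊨ B1 π μ → Sat (𝒞 𝔄) (B1 π μ)
  sat-B1 π μ h ξ Π (a , ct , pt) π∈ξ with ∈ctp⇒realized ct π∈ξ
  ... | c , a~c , tc with h c tc
  ... | b , μb , tcb , c≢b with dec (c ~ b)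
  ... | no c≁b = inj₂ (inj₂ (ftp 𝔄 b , proj₂ (pt (ftp 𝔄 b)) (b , ~-T-trans a~c tcb , ¬tba , refl) , μb))
    where
    ¬tba : ¬ T b a
    ¬tba tba = c≁b (inj₂ (tcb , T-~-trans tba a~c))
  ... | yes c~b with dec (ftp 𝔄 b ≡ π)
  ...   | yes tb = inj₁ (subst (_⊨→ μ) tb μb ,
                         two⇒m2 (ξ π) (ctp-at ct π) c b c≢b a~c (~-trans a~c c~b) tc tb)
  ...   | no ¬tb = inj₂ (inj₁ (ftp 𝔄 b , ~⇒∈ctp ct (~-trans a~c c~b) , ¬tb , μb))

  sat-B2 : ∀ π μ → 𝔄 ⊨ B2 π μ → Sat (𝒞 𝔄) (B2 π μ)
  sat-B2 π μ h ξ Π (a , ct , pt) π∈ξ with ∈ctp⇒realized ct π∈ξ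
  ... | c , a~c , tc with h c tc
  ... | b , μb , ¬tcb , c≢b =
    ctp b , typesAbove b , ftp 𝔄 b , cstp-realized b , ~⇒∈ctp (ctp-correct b) ~-refl , μb ,
    ¬Π≪ctp , ¬ctp∩Π∩V , same⇒¬MeetsV
    where
    -- Each of the three conditions would force T(c,b).
    ¬Π≪ctp : ¬ (∃[ π'' ] ∃[ π''' ] (π'' ∈Π Π × π''' ∈ξ ctp b × π'' ≪ π'''))
    ¬Π≪ctp (π'' , π''' , π''∈Π , π'''∈ξ , lift (_ , _ , all , _))
      with proj₁ (pt π'') π''∈Π | ∈ctp⇒realized (ctp-correct b) π'''∈ξ
    ... | d , tad , _ , td | e , b~e , te =
      ¬tcb (T-~-trans (~-T-trans (~-sym a~c) (T-trans tad (all d td e te))) (~-sym b~e))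

    ¬ctp∩Π∩V : ¬ (∃[ ρ ] (ρ ∈ξ ctp b × ρ ∈Π Π × V ρ))
    ¬ctp∩Π∩V (ρ , ρ∈ξ , ρ∈Π , v)
      with ∈ctp⇒realized (ctp-correct b) ρ∈ξ | proj₁ (pt ρ) ρ∈Π
    ... | e , b~e , te | d , tad , _ , td =
      ¬tcb (T-~-trans (~-T-trans (~-sym a~c) tad) (~-trans (V⇒~ v td te) (~-sym b~e)))

    same⇒¬MeetsV : ξ ≗ ctp b × Π ≗ typesAbove b → ¬ MeetsV (𝒞 𝔄) ξ
    same⇒¬MeetsV (ξ≗ , _) (ρ , ρ∈ξ , v)
      with ∈ctp⇒realized ct ρ∈ξ
         | ∈ctp⇒realized (ctp-correct b) (λ e → ρ∈ξ (trans (ξ≗ ρ) e))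
    ... | x , a~x , tx | y , b~y , ty =
      ¬tcb (~⇒T (~-trans (~-sym a~c) (~-trans a~x (~-trans (V⇒~ v tx ty) (~-sym b~y)))) c≢b)

  sat-B3 : ∀ π π' (π≢π' : π ≢ π') → Quadratic 𝔄 → 𝔄 ⊨ B3 π π' π≢π' → Sat (𝒞 𝔄) (B3 π π' π≢π')
  sat-B3 π π' π≢π' quadratic h with dec (𝔄 ⊨ B3 π' π (λ e → π≢π' (sym e)))
  ... | no ¬h' with dec (Realized 𝔄 π) | dec (Realized 𝔄 π')
  ...   | yes r | yes r' = inj₂ (inj₂ (inj₁ (lift (r , r' , h , ¬h'))))
  ...   | no ¬r | _      = inj₁ (λ o → ¬r (occurs⇒realized o))
  ...   | yes _ | no ¬r' = inj₂ (inj₁ (λ o → ¬r' (occurs⇒realized o)))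
  sat-B3 π π' π≢π' quadratic h | yes h' = inj₂ (inj₂ (inj₂ one-clique))
    where
    π~π' : ∀ {c c'} → ftp 𝔄 c ≡ π → ftp 𝔄 c' ≡ π' → c ~ c'
    π~π' {c} {c'} tc tc' = inj₂ (h c tc c' tc' , h' c' tc' c tc)

    one-clique : ∀ ξ Π ξ' Π' → Ω (ξ , Π) → Ω (ξ' , Π') → π ∈ξ ξ → π' ∈ξ ξ' →
                 ξ ≗ ξ' × Π ≗ Π' × MeetsV (𝒞 𝔄) ξ
    one-clique ξ Π ξ' Π' (a , ct , pt) (a' , ct' , pt') π∈ξ π'∈ξ'
      with ∈ctp⇒realized ct π∈ξ | ∈ctp⇒realized ct' π'∈ξ'
    ... | c , a~c , tc | c' , a'~c' , tc' =
      ctp-unique ct ct' a~a' , typesAbove-unique pt pt' a~a' , meets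
      where
      a~a' = ~-trans a~c (~-trans (π~π' tc tc') (~-sym a'~c'))

      unique : ∀ B → IsClique 𝔄 B → RealizedIn 𝔄 B π → RealizedIn 𝔄 B π' → SameSet 𝔄 B [ c ]
      unique B cB (x , bx , tx) (y , _ , ty) =
        clique≐[] cB bx (~-trans (π~π' tc ty) (~-sym (π~π' tx ty)))

      meets : MeetsV (𝒞 𝔄) ξ
      meets with quadratic π π' π≢π' [ c ] ([]-isClique c) (c , ~-refl , tc)
                           (c' , π~π' tc tc' , tc') unique
      ... | π* , (x , c~x , tx) , unique* =
        π* , subst (_∈ξ ξ) tx (~⇒∈ctp ct (~-trans a~c c~x)) ,
        ([ c ] , []-isClique c , (x , c~x , tx) , unique*)

  sat-B4 : ∀ π π' (π≢π' : π ≢ π') → 𝔄 ⊨ B4 π π' π≢π' → Sat (𝒞 𝔄) (B4 π π' π≢π')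
  sat-B4 π π' π≢π' h ξ Π (a , ct , pt) π∈ξ with ∈ctp⇒realized ct π∈ξ
  ... | c , a~c , tc = π'∉ξ , π'∉Π
    where
    π'∉ξ : ¬ π' ∈ξ ξ
    π'∉ξ π'∈ξ with ∈ctp⇒realized ct π'∈ξ
    ... | c' , a~c' , tc' =
      h c tc c' tc' (~⇒T (~-trans (~-sym a~c) a~c')
                         (λ c≡c' → π≢π' (trans (sym tc) (trans (cong (ftp 𝔄) c≡c') tc'))))

    π'∉Π : ¬ π' ∈Π Π
    π'∉Π π'∈Π with proj₁ (pt π') π'∈Π
    ... | d , tad , _ , td = h c tc d td (~-T-trans (~-sym a~c) tad)

  sat-B5 : ∀ π → 𝔄 ⊨ B5 π → Sat (𝒞 𝔄) (B5 π)
  sat-B5 π h = one-cstp , meets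
    where
    π~π : ∀ {c c'} → ftp 𝔄 c ≡ π → ftp 𝔄 c' ≡ π → c ~ c'
    π~π {c} {c'} tc tc' = ≡⊎T⇒~ (h c tc c' tc') (h c' tc' c tc)

    one-cstp : ∀ ξ Π ξ' Π' → Ω (ξ , Π) → Ω (ξ' , Π') → π ∈ξ ξ → π ∈ξ ξ' → ξ ≗ ξ' × Π ≗ Π'
    one-cstp ξ Π ξ' Π' (a , ct , pt) (a' , ct' , pt') π∈ξ π∈ξ'
      with ∈ctp⇒realized ct π∈ξ | ∈ctp⇒realized ct' π∈ξ'
    ... | c , a~c , tc | c' , a'~c' , tc' = ctp-unique ct ct' a~a' , typesAbove-unique pt pt' a~a'
      where a~a' = ~-trans a~c (~-trans (π~π tc tc') (~-sym a'~c'))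

    meets : ∀ ξ Π → Ω (ξ , Π) → π ∈ξ ξ → MeetsV (𝒞 𝔄) ξ
    meets ξ Π (a , ct , pt) π∈ξ with ∈ctp⇒realized ct π∈ξ
    ... | c , a~c , tc =
      π , π∈ξ , ([ c ] , []-isClique c , (c , ~-refl , tc) ,
                 λ B cB (x , bx , tx) → clique≐[] cB bx (π~π tc tx))

  sat-B6 : ∀ π → 𝔄 ⊨ B6 π → Sat (𝒞 𝔄) (B6 π)
  sat-B6 π h ξ Π (a , ct , pt) = π∉ξ∩Π , ξπ≢m2
    where
    π∉ξ∩Π : ¬ (π ∈ξ ξ × π ∈Π Π)
    π∉ξ∩Π (π∈ξ , π∈Π) with ∈ctp⇒realized ct π∈ξ | proj₁ (pt π) π∈Π
    ... | c , a~c , tc | d , tad , ¬tda , td with h c tc d td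
    ... | inj₁ refl = strict⇒≁ tad ¬tda a~c
    ... | inj₂ ¬tcd = ¬tcd (~-T-trans (~-sym a~c) tad)

    ξπ≢m2 : ξ π ≢ m2
    ξπ≢m2 ξπ≡m2 with subst (λ m → HasMult 𝔄 m [ a ] π) ξπ≡m2 (ctp-at ct π)
    ... | x , y , x≢y , a~x , a~y , tx , ty with h x tx y ty
    ... | inj₁ x≡y = x≢y x≡y
    ... | inj₂ ¬txy = ¬txy (~⇒T (~-trans (~-sym a~x) a~y) x≢y)

  sat-B7 : ∀ μ → 𝔄 ⊨ B7 μ → Sat (𝒞 𝔄) (B7 μ)
  sat-B7 μ h ξ Π (a , ct , _) π π∈ξ with ∈ctp⇒realized ct π∈ξ
  ... | c , _ , tc = subst (_⊨→ μ) tc (h c)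

  sat-B8 : ∀ μ → 𝔄 ⊨ B8 μ → Sat (𝒞 𝔄) (B8 μ)
  sat-B8 μ (a , μa) = ctp a , typesAbove a , ftp 𝔄 a , cstp-realized a , ~⇒∈ctp (ctp-correct a) ~-refl , μa

lemma3p9 : ExcludedMiddle (lsuc 0ℓ) →
    ∀ {n : ℕ} (ψ : Basic n) (𝔄 : Structure n) →
    Quadratic 𝔄 → 𝔄 ⊨ ψ → Sat (𝒞 𝔄) ψ
lemma3p9 em (B1 π μ)       𝔄 _ h = Classical.sat-B1 em 𝔄 π μ h
lemma3p9 em (B2 π μ)       𝔄 _ h = Classical.sat-B2 em 𝔄 π μ h
lemma3p9 em (B3 π π' π≢π') 𝔄 q h = Classical.sat-B3 em 𝔄 π π' π≢π' q h
lemma3p9 em (B4 π π' π≢π') 𝔄 _ h = Classical.sat-B4 em 𝔄 π π' π≢π' h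
lemma3p9 em (B5 π)         𝔄 _ h = Classical.sat-B5 em 𝔄 π h
lemma3p9 em (B6 π)         𝔄 _ h = Classical.sat-B6 em 𝔄 π h
lemma3p9 em (B7 μ)         𝔄 _ h = Classical.sat-B7 em 𝔄 μ h
lemma3p9 em (B8 μ)         𝔄 _ h = Classical.sat-B8 em 𝔄 μ h
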